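{- Let $D_0$ be a diagram. Suppose there exist $D\in KD(D_0)$ and positive integers $r^*,c_1,c_2$ with $c_1<c_2$ such that either (a) $(r^*+1,c_1),(r^*+2,c_1),(r^*+1,c_2)\in D$; $(r^*+2,\tilde c)\notin D$ for all $\tilde c>c_1$; $(r^*+1,\tilde c)\notin D$ for all $\tilde c$ with $c_1<\tilde c<c_2$ and all $\tilde c>c_2$; and $(r^*,c_1),(r^*,c_2)\notin D$; or (b) $(r^*+1,c_1),(r^*+2,c_1),(r^*,c_2),(r^*+2,c_2)\in D$; $(r^*+2,\tilde c)\notin D$ for all $\tilde c>c_2$; $(r^*+1,\tilde c)\notin D$ for all $\tilde c>c_1$; and $(r^*,c_1)\notin D$. Then $\mathcal{P}(D_0)$ is not ranked.
   Context: A diagram is a finite set $D$ of cells $(r,c)$ with $r,c$ positive integers; $r$ is the row (rows numbered from bottom to top starting at 1) and $c$ the column (numbered from left to right starting at 1). A Kohnert move at row $r$ applied to a diagram $D$: if row $r$ of $D$ is empty, $D$ is unchanged; otherwise let $(r,c)$ be the cell of row $r$ with the largest column index; if every position $(r',c)$ with $1\le r'<r$ belongs to $D$, then $D$ is unchanged; otherwise let $r'$ be the largest integer with $1\le r'<r$ and $(r',c)\notin D$, and the move replaces the cell $(r,c)$ by $(r',c)$. For a diagram $D_0$, $KD(D_0)$ is the set of all diagrams obtainable from $D_0$ by finite (possibly empty) sequences of Kohnert moves; the Kohnert poset $\mathcal{P}(D_0)$ is $KD(D_0)$ ordered by $D_2\preceq D_1$ iff $D_2$ can be obtained from $D_1$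 by a finite sequence of Kohnert moves. A finite poset $P$ is ranked if there is a function $\rho:P\to\mathbb{Z}_{\ge0}$ such that $x\prec y$ implies $\rho(x)<\rho(y)$ and $\rho(y)=\rho(x)+1$ whenever $y$ covers $x$. -}

module Defs where

open import Data.Nat using (ℕ; zero; suc; _+_; _≤_; _<_)
open import Data.Product using (Σ; ∃; _×_; _,_)
open import Data.Sum using (_⊎_)
open import Data.List using (List)
open import Data.List.Membership.Propositional using (_∈_; _∉_)
open import Data.List.Relation.Unary.All using (All)
open import Relation.Binary.PropositionalEquality using (_≡_; _≢_)
open import Relation.Nullary using (¬_)

-- A cell (r , c): r = row (bottom to top, from 1), c = column (from 1).
Cell : Set
Cell = ℕ × ℕ

-- A diagram is a finite set of cells, represented by a list; lists are
-- considered only up to having the same members (_≈D_), i.e. as finite sets.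
Diagram : Set
Diagram = List Cell

ValidDiagram : Diagram → Set
ValidDiagram D = All (λ x → 1 ≤ Data.Product.proj₁ x × 1 ≤ Data.Product.proj₂ x) D

_≈D_ : Diagram → Diagram → Set
D ≈D E = ∀ x → (x ∈ D → x ∈ E) × (x ∈ E → x ∈ D)

-- A Kohnert move at row r that changes the diagram: (r , c) is the rightmost
-- cell of row r, r' is the largest row index with 1 ≤ r' < r and (r' , c) ∉ D,
-- and E is D with (r , c) replaced by (r' , c).
-- (Moves that leave D unchanged are omitted: they do not affect reachability.)
KohnertStep : Diagram → Diagram → Set
KohnertStep D E =
  Σ ℕ λ r → Σ ℕ λ c → Σ ℕ λ r' →
    ((r , c) ∈ D) ×
    (∀ c' → (r , c') ∈ D → c' ≤ c) ×
    (1 ≤ r') × (r' < r) × ((r' , c) ∉ D) ×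
    (∀ s → r' < s → s < r → (s , c) ∈ D) ×
    (∀ x → (x ∈ E → (x ∈ D × x ≢ (r , c)) ⊎ x ≡ (r' , c))
         × ((x ∈ D × x ≢ (r , c)) ⊎ x ≡ (r' , c) → x ∈ E))

data _⇝_ : Diagram → Diagram → Set where
  done : ∀ {D E} → D ≈D E → D ⇝ E
  step : ∀ {D D' E} → KohnertStep D D' → D' ⇝ E → D ⇝ E

InKD : Diagram → Diagram → Set
InKD D₀ D = D₀ ⇝ D

_⪯_ : Diagram → Diagram → Set
D₂ ⪯ D₁ = D₁ ⇝ D₂

_≺_ : Diagram → Diagram → Set
D₂ ≺ D₁ = (D₂ ⪯ D₁) × ¬ (D₂ ≈D D₁)

Covers : Diagram → Diagram → Diagram → Set
Covers D₀ y x = (x ≺ y) × (∀ z → InKD D₀ z → x ≺ z → z ≺ y → Data.Empty.⊥)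
  where import Data.Empty

Ranked : Diagram → Set
Ranked D₀ =
  Σ (Diagram → ℕ) λ ρ →
    (∀ x y → InKD D₀ x → InKD D₀ y → x ≺ y → ρ x < ρ y) ×
    (∀ x y → InKD D₀ x → InKD D₀ y → Covers D₀ y x → ρ y ≡ suc (ρ x))

CondA : Diagram → ℕ → ℕ → ℕ → Set
CondA D r c₁ c₂ =
  ((r + 1 , c₁) ∈ D) × ((r + 2 , c₁) ∈ D) × ((r + 1 , c₂) ∈ D) ×
  (∀ c → c₁ < c → (r + 2 , c) ∉ D) ×
  (∀ c → c₁ < c → c < c₂ → (r + 1 , c) ∉ D) ×
  (∀ c → c₂ < c → (r + 1 , c) ∉ D) ×
  ((r , c₁) ∉ D) × ((r , c₂) ∉ D)

CondB : Diagram → ℕ → ℕ → ℕ → Set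
CondB D r c₁ c₂ =
  ((r + 1 , c₁) ∈ D) × ((r + 2 , c₁) ∈ D) × ((r , c₂) ∈ D) × ((r + 2 , c₂) ∈ D) ×
  (∀ c → c₂ < c → (r + 2 , c) ∉ D) ×
  (∀ c → c₁ < c → (r + 1 , c) ∉ D) ×
  ((r , c₁) ∉ D)

-- A Kohnert move from row r to row r′ lowers the total row index of a diagram by exactly r − r′.
-- Hence in P(D₀) a move to the adjacent row is a cover, and so is a jump of two rows over an
-- occupied cell when the middle row also has a cell further right: the intermediate diagram would
-- have to arise from two single-row drops, and these cannot remove the top cell.
-- Under (a), jumping the top cell of column c₁ and then dropping (r+1, c₂), versus dropping
-- (r+1, c₂), the middle cell and the top cell, are maximal chains of lengths 2 and 3 between the
-- same diagrams. Under (b), dropping the middle cell is a cover D ⋗ E′, yet ρ D = ρ E′: pushing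
-- the cells of row r+2 right of c₁ one row down, in D and E′ alike, gives covers on both sides,
-- until row r+2 ends at c₁; there the jump of the top cell from D and its drop from E′ reach the
-- same diagram.

module Submission where

open import Defs
open import Data.Nat using (ℕ; zero; suc; _+_; _≤_; _<_; z≤n; s≤s; _⊔_; _≟_)
open import Data.Nat.Properties
open import Data.Product using (Σ; _×_; _,_; proj₁; proj₂)
open import Data.Product.Properties using (≡-dec; ,-injectiveˡ; ,-injectiveʳ)
open import Data.Sum using (_⊎_; inj₁; inj₂)
import Data.Sum as Sum
import Data.Product as Product
open import Data.List using ([]; _∷_; filter)
open import Data.List.Membership.Propositional using (_∈_; _∉_)
open import Data.List.Relation.Binary.Subset.Propositional using (_⊆_)
open import Data.List.Membership.Propositional.Properties using (∈-filter⁺; ∈-filter⁻)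
open import Data.List.Relation.Unary.Any using (here; there)
open import Data.Empty using (⊥; ⊥-elim)
open import Relation.Binary.Definitions using (DecidableEquality; tri<; tri≈; tri>)
open import Relation.Binary.PropositionalEquality
open import Relation.Nullary using (¬_; Dec; does; yes; no; ¬?)
open import Relation.Nullary.Decidable using (dec-true; dec-false)
open import Data.Bool using (if_then_else_)
open import Function using (_∘_)
open import Algebra.Properties.CommutativeSemigroup +-commutativeSemigroup using (interchange)

_≟ᶜ_ : DecidableEquality Cell
_≟ᶜ_ = ≡-dec _≟_ _≟_

open import Data.List.Membership.DecPropositional _≟ᶜ_ using (_∈?_)

row-≢ : ∀ {a b c d} → b < a → _≢_ {A = Cell} (a , c) (b , d)
row-≢ b<a eq = <⇒≢ b<a (sym (,-injectiveˡ eq))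

col-≢ : ∀ {a b c d} → c ≢ d → _≢_ {A = Cell} (a , c) (b , d)
col-≢ c≢d eq = c≢d (,-injectiveʳ eq)

≈D-refl : ∀ {D} → D ≈D D
≈D-refl x = (λ m → m) , (λ m → m)

≈D-sym : ∀ {D E} → D ≈D E → E ≈D D
≈D-sym D≈E x = proj₂ (D≈E x) , proj₁ (D≈E x)

≈D-trans : ∀ {D E F} → D ≈D E → E ≈D F → D ≈D F
≈D-trans D≈E E≈F x = (λ m → proj₁ (E≈F x) (proj₁ (D≈E x) m)) , (λ m → proj₂ (D≈E x) (proj₂ (E≈F x) m))

Moved : Diagram → Diagram → Cell → Cell → Set
Moved E D p q = ∀ x → (x ∈ E → (x ∈ D × x ≢ p) ⊎ x ≡ q) × ((x ∈ D × x ≢ p) ⊎ x ≡ q → x ∈ E)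

move : Diagram → Cell → Cell → Diagram
move D p q = q ∷ filter (λ x → ¬? (x ≟ᶜ p)) D

module _ {E D : Diagram} {p q : Cell} (mv : Moved E D p q) where

  Moved⁻ : ∀ {x} → x ∈ E → (x ∈ D × x ≢ p) ⊎ x ≡ q
  Moved⁻ = proj₁ (mv _)

  Moved⁺ : ∀ {x} → x ∈ D → x ≢ p → x ∈ E
  Moved⁺ x∈D x≢p = proj₂ (mv _) (inj₁ (x∈D , x≢p))

  Moved-target : q ∈ E
  Moved-target = proj₂ (mv _) (inj₂ refl)

  Moved-source∉ : p ≢ q → p ∉ E
  Moved-source∉ p≢q p∈E with Moved⁻ p∈E
  ... | inj₁ (_ , p≢p) = p≢p refl
  ... | inj₂ p≡q = p≢q p≡q

  Moved-∉ : ∀ {x} → x ∉ D → x ≢ q → x ∉ E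
  Moved-∉ x∉D x≢q x∈E with Moved⁻ x∈E
  ... | inj₁ (x∈D , _) = x∉D x∈D
  ... | inj₂ x≡q = x≢q x≡q

move-Moved : ∀ D p q → Moved (move D p q) D p q
move-Moved D p q x = to , from
  where
  to : x ∈ move D p q → (x ∈ D × x ≢ p) ⊎ x ≡ q
  to (here x≡q) = inj₂ x≡q
  to (there x∈D∖p) = inj₁ (∈-filter⁻ (λ y → ¬? (y ≟ᶜ p)) x∈D∖p)
  from : (x ∈ D × x ≢ p) ⊎ x ≡ q → x ∈ move D p q
  from (inj₂ x≡q) = here x≡q
  from (inj₁ (x∈D , x≢p)) = there (∈-filter⁺ (λ y → ¬? (y ≟ᶜ p)) x∈D x≢p)

Moved-respˡ-≈ : ∀ {E E′ D p q} → E ≈D E′ → Moved E D p q → Moved E′ D p q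
Moved-respˡ-≈ E≈E′ mv x = proj₁ (mv x) ∘ proj₂ (E≈E′ x) , proj₁ (E≈E′ x) ∘ proj₂ (mv x)

Moved-respʳ-≈ : ∀ {E D D′ p q} → D ≈D D′ → Moved E D p q → Moved E D′ p q
Moved-respʳ-≈ D≈D′ mv x =
  Sum.map₁ (Product.map₁ (proj₁ (D≈D′ x))) ∘ proj₁ (mv x) , proj₂ (mv x) ∘ Sum.map₁ (Product.map₁ (proj₂ (D≈D′ x)))

Moved-row⁻ : ∀ {E D p q R c} → Moved E D p q → proj₁ q ≢ R → (R , c) ∈ E → (R , c) ∈ D
Moved-row⁻ mv q≢R x∈E with Moved⁻ mv x∈E
... | inj₁ (x∈D , _) = x∈D
... | inj₂ refl = ⊥-elim (q≢R refl)

Moved⇒≈move : ∀ {E D p q} → Moved E D p q → E ≈D move D p q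
Moved⇒≈move {D = D} {p} {q} mv x = proj₂ (move-Moved D p q x) ∘ proj₁ (mv x) , proj₂ (mv x) ∘ proj₁ (move-Moved D p q x)

⊆-antisym-≈D : ∀ {D E} → D ⊆ E → E ⊆ D → D ≈D E
⊆-antisym-≈D D⊆E E⊆D x = D⊆E , E⊆D

move-cong : ∀ {D D′} p q → D ≈D D′ → move D p q ≈D move D′ p q
move-cong p q D≈D′ = ⊆-antisym-≈D (transport D≈D′) (transport (≈D-sym D≈D′))
  where
  transport : ∀ {A B} → A ≈D B → move A p q ⊆ move B p q
  transport {A} {B} A≈B x∈ with Moved⁻ (move-Moved A p q) x∈
  ... | inj₁ (x∈A , x≢p) = Moved⁺ (move-Moved B p q) (proj₁ (A≈B _) x∈A) x≢p
  ... | inj₂ refl = Moved-target (move-Moved B p q)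

move-comm : ∀ D {a c s t} → c ≢ s → t ≢ a → move (move D a c) s t ≈D move (move D s t) a c
move-comm D c≢s t≢a = ⊆-antisym-≈D (swap c≢s t≢a) (swap t≢a c≢s)
  where
  swap : ∀ {a c s t} → c ≢ s → t ≢ a → move (move D a c) s t ⊆ move (move D s t) a c
  swap {a} {c} {s} {t} c≢s t≢a x∈ with Moved⁻ (move-Moved (move D a c) s t) x∈
  ... | inj₂ refl = Moved⁺ (move-Moved (move D s t) a c) (Moved-target (move-Moved D s t)) t≢a
  ... | inj₁ (x∈D∖a , x≢s) with Moved⁻ (move-Moved D a c) x∈D∖a
  ...   | inj₂ refl = Moved-target (move-Moved (move D s t) a c)
  ...   | inj₁ (x∈D , x≢a) = Moved⁺ (move-Moved (move D s t) a c) (Moved⁺ (move-Moved D s t) x∈D x≢s) x≢a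

move-move : ∀ D {a b c} → b ∈ D → b ≢ a → c ≢ a → move (move D b c) a b ≈D move D a c
move-move D {a} {b} {c} b∈D b≢a c≢a = ⊆-antisym-≈D twice once
  where
  D′ = move D b c
  twice : move (move D b c) a b ⊆ move D a c
  twice x∈ with Moved⁻ (move-Moved D′ a b) x∈
  ... | inj₂ refl = Moved⁺ (move-Moved D a c) b∈D b≢a
  ... | inj₁ (x∈D∖b , x≢a) with Moved⁻ (move-Moved D b c) x∈D∖b
  ...   | inj₂ refl = Moved-target (move-Moved D a c)
  ...   | inj₁ (x∈D , _) = Moved⁺ (move-Moved D a c) x∈D x≢a
  once : move D a c ⊆ move (move D b c) a b
  once {x} x∈ with Moved⁻ (move-Moved D a c) x∈ | x ≟ᶜ b
  ... | inj₂ refl | _ = Moved⁺ (move-Moved D′ a b) (Moved-target (move-Moved D b c)) c≢a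
  ... | inj₁ _ | yes refl = Moved-target (move-Moved D′ a b)
  ... | inj₁ (x∈D , x≢a) | no x≢b = Moved⁺ (move-Moved D′ a b) (Moved⁺ (move-Moved D b c) x∈D x≢b) x≢a

Rightmost : Diagram → ℕ → ℕ → Set
Rightmost D r c = ∀ c′ → (r , c′) ∈ D → c′ ≤ c

drop-step : ∀ {D r c} → (suc r , c) ∈ D → Rightmost D (suc r) c → 1 ≤ r → (r , c) ∉ D →
            KohnertStep D (move D (suc r , c) (r , c))
drop-step {D} {r} {c} top rightmost r≥1 below∉ =
  suc r , c , r , top , rightmost , r≥1 , ≤-refl , below∉ ,
  (λ s r<s s≤r → ⊥-elim (<⇒≱ r<s (≤-pred s≤r))) , move-Moved D (suc r , c) (r , c)

jump-step : ∀ {D r c} → (suc (suc r) , c) ∈ D → Rightmost D (suc (suc r)) c → 1 ≤ r →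
            (r , c) ∉ D → (suc r , c) ∈ D → KohnertStep D (move D (suc (suc r) , c) (r , c))
jump-step {D} {r} {c} top rightmost r≥1 bottom∉ middle =
  suc (suc r) , c , r , top , rightmost , r≥1 , m<n⇒m<1+n ≤-refl , bottom∉ ,
  (λ s r<s s≤1+r → subst (λ s → (s , c) ∈ D) (≤-antisym r<s (≤-pred s≤1+r)) middle) ,
  move-Moved D (suc (suc r) , c) (r , c)

KohnertStep-respˡ-≈ : ∀ {D D′ E} → D ≈D D′ → KohnertStep D E → KohnertStep D′ E
KohnertStep-respˡ-≈ D≈D′ (r , c , r′ , top , rightmost , r′≥1 , r′<r , below∉ , gap , mv) =
  r , c , r′ , proj₁ (D≈D′ _) top , (λ c′ h → rightmost c′ (proj₂ (D≈D′ _) h)) , r′≥1 , r′<r ,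
  below∉ ∘ proj₂ (D≈D′ _) , (λ s r′<s s<r → proj₁ (D≈D′ _) (gap s r′<s s<r)) , Moved-respʳ-≈ D≈D′ mv

⇝-snoc : ∀ {A D E} → A ⇝ D → KohnertStep D E → A ⇝ E
⇝-snoc (done A≈D) s = step (KohnertStep-respˡ-≈ (≈D-sym A≈D) s) (done ≈D-refl)
⇝-snoc (step s′ rest) s = step s′ (⇝-snoc rest s)

⇝-respʳ-≈ : ∀ {D E E′} → D ⇝ E → E ≈D E′ → D ⇝ E′
⇝-respʳ-≈ (done D≈E) E≈E′ = done (≈D-trans D≈E E≈E′)
⇝-respʳ-≈ (step s rest) E≈E′ = step s (⇝-respʳ-≈ rest E≈E′)

Covers-respʳ-≈ : ∀ {D₀ y x x′} → Covers D₀ y x → x ≈D x′ → Covers D₀ y x′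
Covers-respʳ-≈ ((y⇝x , x≉y) , between) x≈x′ =
  (⇝-respʳ-≈ y⇝x x≈x′ , (λ x′≈y → x≉y (≈D-trans x≈x′ x′≈y))) ,
  λ z z∈KD (z⇝x′ , x′≉z) z≺y →
    between z z∈KD (⇝-respʳ-≈ z⇝x′ (≈D-sym x≈x′) , (λ x≈z → x′≉z (≈D-trans (≈D-sym x≈x′) x≈z))) z≺y

sumTo : ℕ → (ℕ → ℕ) → ℕ
sumTo zero f = 0
sumTo (suc n) f = sumTo n f + f n

sumTo-cong : ∀ n {f g} → (∀ i → f i ≡ g i) → sumTo n f ≡ sumTo n g
sumTo-cong zero f≗g = refl
sumTo-cong (suc n) f≗g = cong₂ _+_ (sumTo-cong n f≗g) (f≗g n)

sumTo-+ : ∀ n f g → sumTo n (λ i → f i + g i) ≡ sumTo n f + sumTo n g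
sumTo-+ zero f g = refl
sumTo-+ (suc n) f g = trans (cong (_+ (f n + g n)) (sumTo-+ n f g)) (interchange (sumTo n f) (sumTo n g) (f n) (g n))

sumTo-zero : ∀ n f → (∀ i → i < n → f i ≡ 0) → sumTo n f ≡ 0
sumTo-zero zero f f≡0 = refl
sumTo-zero (suc n) f f≡0 = cong₂ _+_ (sumTo-zero n f (λ i i<n → f≡0 i (m<n⇒m<1+n i<n))) (f≡0 n ≤-refl)

sumTo-point : ∀ n f {a} → a < n → (∀ i → i ≢ a → f i ≡ 0) → sumTo n f ≡ f a
sumTo-point (suc n) f {a} a<1+n f≡0 with n ≟ a
... | yes refl = cong (_+ f n) (sumTo-zero n f (λ i i<n → f≡0 i (<⇒≢ i<n)))
... | no n≢a = begin
  sumTo n f + f n ≡⟨ cong₂ _+_ (sumTo-point n f a<n f≡0) (f≡0 n n≢a) ⟩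
  f a + 0         ≡⟨ +-identityʳ (f a) ⟩
  f a             ∎
  where
  open ≡-Reasoning
  a<n : a < n
  a<n = ≤∧≢⇒< (≤-pred a<1+n) (≢-sym n≢a)

InBox : ℕ → Cell → Set
InBox N (r , c) = r < N × c < N

Boxed : ℕ → Diagram → Set
Boxed N D = ∀ {x} → x ∈ D → InBox N x

sumBox : ℕ → (Cell → ℕ) → ℕ
sumBox N g = sumTo N (λ i → sumTo N (λ j → g (i , j)))

sumBox-cong : ∀ N {f g} → (∀ x → f x ≡ g x) → sumBox N f ≡ sumBox N g
sumBox-cong N f≗g = sumTo-cong N (λ i → sumTo-cong N (λ j → f≗g (i , j)))

sumBox-+ : ∀ N f g → sumBox N (λ x → f x + g x) ≡ sumBox N f + sumBox N g
sumBox-+ N f g = trans (sumTo-cong N (λ i → sumTo-+ N (λ j → f (i , j)) (λ j → g (i , j)))) (sumTo-+ N _ _)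

sumBox-point : ∀ N g {p} → InBox N p → (∀ x → x ≢ p → g x ≡ 0) → sumBox N g ≡ g p
sumBox-point N g {a , b} (a<N , b<N) g≡0 =
  trans (sumTo-point N _ a<N (λ i i≢a → sumTo-zero N _ (λ j _ → g≡0 (i , j) (i≢a ∘ ,-injectiveˡ))))
        (sumTo-point N _ b<N (λ j j≢b → g≡0 (a , j) (j≢b ∘ ,-injectiveʳ)))

weightIf : ∀ {A : Set} → Dec A → ℕ → ℕ
weightIf a? n = if does a? then n else 0

weightIf-yes : ∀ {A : Set} (a? : Dec A) {n} → A → weightIf a? n ≡ n
weightIf-yes a? a rewrite dec-true a? a = refl

weightIf-no : ∀ {A : Set} (a? : Dec A) {n} → ¬ A → weightIf a? n ≡ 0
weightIf-no a? ¬a rewrite dec-false a? ¬a = refl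

inWeight : Diagram → Cell → ℕ
inWeight D x = weightIf (x ∈? D) (proj₁ x)

atWeight : Cell → Cell → ℕ
atWeight p x = weightIf (x ≟ᶜ p) (proj₁ x)

-- Summed over a box rather than over the list, so that it depends only on the set of cells.
weight : ℕ → Diagram → ℕ
weight N D = sumBox N (inWeight D)

sumBox-atWeight : ∀ N {p} → InBox N p → sumBox N (atWeight p) ≡ proj₁ p
sumBox-atWeight N {p} p∈box =
  trans (sumBox-point N (atWeight p) p∈box (λ x x≢p → weightIf-no (x ≟ᶜ p) x≢p)) (weightIf-yes (p ≟ᶜ p) refl)

weight-resp-≈ : ∀ N {D E} → D ≈D E → weight N D ≡ weight N E
weight-resp-≈ N {D} {E} D≈E = sumBox-cong N pointwise
  where
  pointwise : ∀ x → inWeight D x ≡ inWeight E x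
  pointwise x with x ∈? D
  ... | yes x∈D = sym (weightIf-yes (x ∈? E) (proj₁ (D≈E x) x∈D))
  ... | no x∉D = sym (weightIf-no (x ∈? E) (x∉D ∘ proj₂ (D≈E x)))

weight-move : ∀ N {E D p q} → Boxed N D → Moved E D p q → p ∈ D → q ∉ D → p ≢ q → InBox N q →
              weight N D + proj₁ q ≡ weight N E + proj₁ p
weight-move N {E} {D} {p} {q} D-boxed mv p∈D q∉D p≢q q∈box = begin
  weight N D + proj₁ q                         ≡⟨ cong (weight N D +_) (sumBox-atWeight N q∈box) ⟨
  weight N D + sumBox N (atWeight q)           ≡⟨ sumBox-+ N (inWeight D) (atWeight q) ⟨
  sumBox N (λ x → inWeight D x + atWeight q x) ≡⟨ sumBox-cong N pointwise ⟩
  sumBox N (λ x → inWeight E x + atWeight p x) ≡⟨ sumBox-+ N (inWeight E) (atWeight p) ⟩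
  weight N E + sumBox N (atWeight p)           ≡⟨ cong (weight N E +_) (sumBox-atWeight N (D-boxed p∈D)) ⟩
  weight N E + proj₁ p                         ∎
  where
  open ≡-Reasoning
  pointwise : ∀ x → inWeight D x + atWeight q x ≡ inWeight E x + atWeight p x
  pointwise x = cases (x ≟ᶜ p) (x ≟ᶜ q)
    where
    cases : Dec (x ≡ p) → Dec (x ≡ q) → inWeight D x + atWeight q x ≡ inWeight E x + atWeight p x
    cases (yes refl) _ = begin
      inWeight D x + atWeight q x ≡⟨ cong₂ _+_ (weightIf-yes (x ∈? D) p∈D) (weightIf-no (x ≟ᶜ q) p≢q) ⟩
      proj₁ x + 0                 ≡⟨ +-comm (proj₁ x) 0 ⟩
      0 + proj₁ x                 ≡⟨ cong₂ _+_ (weightIf-no (x ∈? E) (Moved-source∉ mv p≢q)) (weightIf-yes (x ≟ᶜ p) refl) ⟨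
      inWeight E x + atWeight p x ∎
    cases (no x≢p) (yes refl) = begin
      inWeight D x + atWeight q x ≡⟨ cong₂ _+_ (weightIf-no (x ∈? D) q∉D) (weightIf-yes (x ≟ᶜ q) refl) ⟩
      0 + proj₁ x                 ≡⟨ +-comm 0 (proj₁ x) ⟩
      proj₁ x + 0                 ≡⟨ cong₂ _+_ (weightIf-yes (x ∈? E) (Moved-target mv)) (weightIf-no (x ≟ᶜ p) x≢p) ⟨
      inWeight E x + atWeight p x ∎
    cases (no x≢p) (no x≢q) = cong₂ _+_ (same-membership (x ∈? D))
      (trans (weightIf-no (x ≟ᶜ q) x≢q) (sym (weightIf-no (x ≟ᶜ p) x≢p)))
      where
      same-membership : Dec (x ∈ D) → inWeight D x ≡ inWeight E x
      same-membership (yes x∈D) = trans (weightIf-yes (x ∈? D) x∈D) (sym (weightIf-yes (x ∈? E) (Moved⁺ mv x∈D x≢p)))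
      same-membership (no x∉D) = trans (weightIf-no (x ∈? D) x∉D) (sym (weightIf-no (x ∈? E) (Moved-∉ mv x∉D x≢q)))

+-exchange-< : ∀ {m n k l} → m + k ≡ n + l → k < l → n < m
+-exchange-< {m} {n} {k} {l} m+k≡n+l k<l = +-cancelʳ-≤ k (suc n) m (begin
  suc n + k ≡⟨ +-suc n k ⟨
  n + suc k ≤⟨ +-monoʳ-≤ n k<l ⟩
  n + l     ≡⟨ m+k≡n+l ⟨
  m + k     ∎)
  where open ≤-Reasoning

+-exchange-≤ : ∀ {m n k l} → m + k ≡ n + l → m ≤ suc n → l ≤ suc k
+-exchange-≤ {m} {n} {k} {l} m+k≡n+l m≤1+n = +-cancelˡ-≤ n l (suc k) (begin
  n + l     ≡⟨ m+k≡n+l ⟨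
  m + k     ≤⟨ +-monoˡ-≤ k m≤1+n ⟩
  suc n + k ≡⟨ +-suc n k ⟨
  n + suc k ∎)
  where open ≤-Reasoning

data UnitDrop (D E : Diagram) : Set where
  unitDrop : ∀ r c → (suc r , c) ∈ D → Rightmost D (suc r) c → (r , c) ∉ D →
             Moved E D (suc r , c) (r , c) → UnitDrop D E

module _ {N : ℕ} where

  step-boxed : ∀ {D E} → Boxed N D → KohnertStep D E → Boxed N E
  step-boxed D-boxed (r , c , r′ , top , _ , _ , r′<r , _ , _ , mv) x∈E with Moved⁻ mv x∈E
  ... | inj₁ (x∈D , _) = D-boxed x∈D
  ... | inj₂ refl = let (r<N , c<N) = D-boxed top in <-trans r′<r r<N , c<N

  ⇝-boxed : ∀ {D E} → Boxed N D → D ⇝ E → Boxed N E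
  ⇝-boxed D-boxed (done D≈E) x∈E = D-boxed (proj₂ (D≈E _) x∈E)
  ⇝-boxed D-boxed (step s rest) = ⇝-boxed (step-boxed D-boxed s) rest

  step-weight : ∀ {D E r c r′} → Boxed N D → (r , c) ∈ D → r′ < r → (r′ , c) ∉ D →
                Moved E D (r , c) (r′ , c) → weight N D + r′ ≡ weight N E + r
  step-weight D-boxed top r′<r below∉ mv =
    weight-move N D-boxed mv top below∉ (row-≢ r′<r) (<-trans r′<r (proj₁ (D-boxed top)) , proj₂ (D-boxed top))

  step-weight-< : ∀ {D E} → Boxed N D → KohnertStep D E → weight N E < weight N D
  step-weight-< D-boxed (r , c , r′ , top , _ , _ , r′<r , below∉ , _ , mv) =
    +-exchange-< (step-weight D-boxed top r′<r below∉ mv) r′<r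

  ⇝-weight-≤ : ∀ {D E} → Boxed N D → D ⇝ E → weight N E ≤ weight N D
  ⇝-weight-≤ D-boxed (done D≈E) = ≤-reflexive (weight-resp-≈ N (≈D-sym D≈E))
  ⇝-weight-≤ D-boxed (step s rest) =
    ≤-trans (⇝-weight-≤ (step-boxed D-boxed s) rest) (<⇒≤ (step-weight-< D-boxed s))

  ⇝-weight-< : ∀ {D E} → Boxed N D → D ⇝ E → ¬ (E ≈D D) → weight N E < weight N D
  ⇝-weight-< D-boxed (done D≈E) E≉D = ⊥-elim (E≉D (≈D-sym D≈E))
  ⇝-weight-< D-boxed (step s rest) E≉D =
    ≤-<-trans (⇝-weight-≤ (step-boxed D-boxed s) rest) (step-weight-< D-boxed s)

  ⇝-rigid : ∀ {D E} → Boxed N D → D ⇝ E → weight N D ≤ weight N E → E ≈D D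
  ⇝-rigid D-boxed (done D≈E) _ = ≈D-sym D≈E
  ⇝-rigid D-boxed (step s rest) D≤E =
    ⊥-elim (<⇒≱ (≤-<-trans (⇝-weight-≤ (step-boxed D-boxed s) rest) (step-weight-< D-boxed s)) D≤E)

  ⇝-unit-drop : ∀ {D E} → Boxed N D → D ⇝ E → ¬ (E ≈D D) → weight N D ≤ suc (weight N E) →
                Σ Diagram λ D₁ → UnitDrop D D₁ × E ≈D D₁
  ⇝-unit-drop D-boxed (done D≈E) E≉D _ = ⊥-elim (E≉D (≈D-sym D≈E))
  ⇝-unit-drop {D} {E} D-boxed (step {D' = D₁} s@(r , c , r′ , top , rightmost , _ , r′<r , below∉ , _ , mv) rest) _ D≤1+E
    with ≤-antisym (+-exchange-≤ weights D≤1+D₁) r′<r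
    where
    weights : weight N D + r′ ≡ weight N D₁ + r
    weights = step-weight D-boxed top r′<r below∉ mv
    D≤1+D₁ : weight N D ≤ suc (weight N D₁)
    D≤1+D₁ = ≤-trans D≤1+E (s≤s (⇝-weight-≤ (step-boxed D-boxed s) rest))
  ... | refl = D₁ , unitDrop r′ c top rightmost below∉ mv ,
               ⇝-rigid (step-boxed D-boxed s) rest (≤-pred (≤-trans (step-weight-< D-boxed s) D≤1+E))

two-unit-drops-keep-top : ∀ {y y₁ z z₁ r c₁ c₂} →
  (suc (suc r) , c₁) ∈ y → (suc r , c₁) ∈ y → (suc r , c₂) ∈ y → c₁ < c₂ →
  UnitDrop y y₁ → UnitDrop z z₁ → z ≈D y₁ → (suc (suc r) , c₁) ∈ z₁
two-unit-drops-keep-top {y} {y₁} {z} {z₁} {r} {c₁} {c₂} top middle right c₁<c₂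
  (unitDrop a b s∈y s-rightmost below-s∉ mv₁) (unitDrop e f _ _ below-t∉ mv₂) z≈y₁
  with (suc e , f) ≟ᶜ (suc (suc r) , c₁)
... | no t≢top = Moved⁺ mv₂ top∈z (≢-sym t≢top)
  where
  s≢top : (suc (suc r) , c₁) ≢ (suc a , b)
  s≢top eq = below-s∉ (subst (_∈ y) (cong₂ _,_ (suc-injective (,-injectiveˡ eq)) (,-injectiveʳ eq)) middle)
  top∈z : (suc (suc r) , c₁) ∈ z
  top∈z = proj₂ (z≈y₁ _) (Moved⁺ mv₁ top s≢top)
... | yes refl = ⊥-elim (below-t∉ (proj₂ (z≈y₁ _) middle∈y₁))
  where
  middle∈y₁ : (suc r , c₁) ∈ y₁
  middle∈y₁ with (suc a , b) ≟ᶜ (suc r , c₁)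
  ... | yes refl = ⊥-elim (<⇒≱ c₁<c₂ (s-rightmost c₂ right))
  ... | no s≢middle = Moved⁺ mv₁ middle (≢-sym s≢middle)

module KohnertPoset {N : ℕ} {D₀ : Diagram} (D₀-boxed : Boxed N D₀) where

  KD-boxed : ∀ {D} → InKD D₀ D → Boxed N D
  KD-boxed D∈KD = ⇝-boxed D₀-boxed D∈KD

  covers-by-weight : ∀ {y x} → InKD D₀ y → y ⇝ x → ¬ (x ≈D y) → weight N y ≤ suc (weight N x) → Covers D₀ y x
  covers-by-weight y∈KD y⇝x x≉y y≤1+x = (y⇝x , x≉y) , λ z z∈KD (z⇝x , x≉z) (y⇝z , z≉y) →
    <⇒≱ (≤-trans (s≤s (⇝-weight-< (KD-boxed z∈KD) z⇝x x≉z)) (⇝-weight-< (KD-boxed y∈KD) y⇝z z≉y)) y≤1+x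

  module _ {y r c} (y∈KD : InKD D₀ y) (top : (suc r , c) ∈ y) (rightmost : Rightmost y (suc r) c)
           (r≥1 : 1 ≤ r) (below∉ : (r , c) ∉ y) where

    drop-KD : InKD D₀ (move y (suc r , c) (r , c))
    drop-KD = ⇝-snoc y∈KD (drop-step top rightmost r≥1 below∉)

    drop-covers : Covers D₀ y (move y (suc r , c) (r , c))
    drop-covers = covers-by-weight y∈KD (step (drop-step top rightmost r≥1 below∉) (done ≈D-refl))
      (λ x≈y → Moved-source∉ mv (row-≢ ≤-refl) (proj₂ (x≈y _) top))
      (≤-reflexive (+-cancelʳ-≡ r _ _ (trans (step-weight (KD-boxed y∈KD) top ≤-refl below∉ mv) (+-suc _ r))))
      where
      mv = move-Moved y (suc r , c) (r , c)

  module _ {y r c} (y∈KD : InKD D₀ y) (top : (suc (suc r) , c) ∈ y) (rightmost : Rightmost y (suc (suc r)) c)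
           (r≥1 : 1 ≤ r) (bottom∉ : (r , c) ∉ y) (middle : (suc r , c) ∈ y) where

    jump-KD : InKD D₀ (move y (suc (suc r) , c) (r , c))
    jump-KD = ⇝-snoc y∈KD (jump-step top rightmost r≥1 bottom∉ middle)

    jump-covers : ∀ {c′} → c < c′ → (suc r , c′) ∈ y → Covers D₀ y (move y (suc (suc r) , c) (r , c))
    jump-covers c<c′ right = (step (jump-step top rightmost r≥1 bottom∉ middle) (done ≈D-refl) , top∉x ∘ top∈) ,
      λ z z∈KD (z⇝x , x≉z) (y⇝z , z≉y) → two-intermediate (KD-boxed z∈KD) z⇝x x≉z y⇝z z≉y
      where
      x = move y (suc (suc r) , c) (r , c)
      mv = move-Moved y (suc (suc r) , c) (r , c)
      top∉x : (suc (suc r) , c) ∉ x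
      top∉x = Moved-source∉ mv (row-≢ (m<n⇒m<1+n ≤-refl))
      top∈ : x ≈D y → (suc (suc r) , c) ∈ x
      top∈ x≈y = proj₂ (x≈y _) top
      y-boxed = KD-boxed y∈KD
      y≡2+x : weight N y ≡ 2 + weight N x
      y≡2+x = +-cancelʳ-≡ r _ _ (trans (step-weight y-boxed top (m<n⇒m<1+n ≤-refl) bottom∉ mv)
                                        (trans (+-suc _ _) (cong suc (+-suc _ _))))
      -- weight z lies strictly between weight x and 2 + weight x, so both halves are unit drops.
      two-intermediate : ∀ {z} → Boxed N z → z ⇝ x → ¬ (x ≈D z) → y ⇝ z → ¬ (z ≈D y) → ⊥
      two-intermediate {z} z-boxed z⇝x x≉z y⇝z z≉y
        with ⇝-unit-drop y-boxed y⇝z z≉y y≤1+z | ⇝-unit-drop z-boxed z⇝x x≉z z≤1+x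
        where
        x<z = ⇝-weight-< z-boxed z⇝x x≉z
        z<y = ⇝-weight-< y-boxed y⇝z z≉y
        y≤1+z : weight N y ≤ suc (weight N z)
        y≤1+z = subst (_≤ suc (weight N z)) (sym y≡2+x) (s≤s x<z)
        z≤1+x : weight N z ≤ suc (weight N x)
        z≤1+x = ≤-pred (subst (weight N z <_) y≡2+x z<y)
      ... | y₁ , y↘y₁ , z≈y₁ | z₁ , z↘z₁ , x≈z₁ =
        top∉x (proj₂ (x≈z₁ _) (two-unit-drops-keep-top top middle right c<c′ y↘y₁ z↘z₁ z≈y₁))

rowMax : ℕ → Diagram → ℕ
rowMax R [] = 0
rowMax R ((a , b) ∷ D) with a ≟ R
... | yes _ = b ⊔ rowMax R D
... | no _ = rowMax R D

rowMax-rightmost : ∀ R D → Rightmost D R (rowMax R D)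
rowMax-rightmost R ((a , b) ∷ D) c x∈ with a ≟ R | x∈
... | yes _ | here refl = m≤m⊔n b _
... | yes _ | there x∈D = ≤-trans (rowMax-rightmost R D c x∈D) (m≤n⊔m b _)
... | no a≢R | here refl = ⊥-elim (a≢R refl)
... | no _ | there x∈D = rowMax-rightmost R D c x∈D

rowMax-0⊎∈ : ∀ R D → rowMax R D ≡ 0 ⊎ (R , rowMax R D) ∈ D
rowMax-0⊎∈ R [] = inj₁ refl
rowMax-0⊎∈ R ((a , b) ∷ D) with a ≟ R | rowMax-0⊎∈ R D
... | yes refl | inj₁ max≡0 = inj₂ (here (cong (a ,_) (trans (cong (b ⊔_) max≡0) (⊔-identityʳ b))))
... | yes refl | inj₂ max∈D with ⊔-sel b (rowMax a D)
...   | inj₁ b⊔max≡b = inj₂ (here (cong (a ,_) b⊔max≡b))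
...   | inj₂ b⊔max≡max = inj₂ (there (subst (λ k → (a , k) ∈ D) (sym b⊔max≡max) max∈D))
rowMax-0⊎∈ R ((a , b) ∷ D) | no _ | inj₁ max≡0 = inj₁ max≡0
rowMax-0⊎∈ R ((a , b) ∷ D) | no _ | inj₂ max∈D = inj₂ (there max∈D)

rowMax-∈ : ∀ {R c} D → (R , c) ∈ D → (R , rowMax R D) ∈ D
rowMax-∈ {R} {c} D x∈D with rowMax-0⊎∈ R D
... | inj₂ max∈D = max∈D
... | inj₁ max≡0 = subst (λ k → (R , k) ∈ D) (trans (n≤0⇒n≡0 c≤0) (sym max≡0)) x∈D
  where
  c≤0 : c ≤ 0
  c≤0 = subst (c ≤_) max≡0 (rowMax-rightmost R D c x∈D)

module NotRanked {N : ℕ} {D₀ : Diagram} (D₀-boxed : Boxed N D₀) (ρ : Diagram → ℕ)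
  (ρ-covers : ∀ x y → InKD D₀ x → InKD D₀ y → Covers D₀ y x → ρ y ≡ suc (ρ x))
  {r c₁ : ℕ} (r≥1 : 1 ≤ r) where

  open KohnertPoset D₀-boxed

  top middle bottom : Cell
  top = (suc (suc r) , c₁)
  middle = (suc r , c₁)
  bottom = (r , c₁)

  r<1+r : r < suc r
  r<1+r = n<1+n r

  1+r<2+r : suc r < suc (suc r)
  1+r<2+r = n<1+n (suc r)

  r<2+r : r < suc (suc r)
  r<2+r = <-trans r<1+r 1+r<2+r

  ρ-covers-≈ : ∀ {y x x′} → InKD D₀ y → InKD D₀ x → Covers D₀ y x → x ≈D x′ → ρ y ≡ suc (ρ x′)
  ρ-covers-≈ y∈KD x∈KD y⋗x x≈x′ = ρ-covers _ _ (⇝-respʳ-≈ x∈KD x≈x′) y∈KD (Covers-respʳ-≈ y⋗x x≈x′)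

  ρ-drop : ∀ {y R c} → InKD D₀ y → (suc R , c) ∈ y → Rightmost y (suc R) c → 1 ≤ R → (R , c) ∉ y →
           ρ y ≡ suc (ρ (move y (suc R , c) (R , c)))
  ρ-drop y∈KD x∈y rightmost R≥1 below∉ =
    ρ-covers _ _ (drop-KD y∈KD x∈y rightmost R≥1 below∉) y∈KD (drop-covers y∈KD x∈y rightmost R≥1 below∉)

  suc-≢ : ∀ {n} → n ≢ suc n
  suc-≢ n≡1+n = 1+n≢n (sym n≡1+n)

  record StackConfig (E : Diagram) : Set where
    field
      middle∈ : middle ∈ E
      top∈ : top ∈ E
      bottom∉ : bottom ∉ E
      gap : ∀ c → c₁ < c → c ≤ rowMax (suc (suc r)) E → (suc r , c) ∉ E
      right : Σ ℕ λ c → c₁ < c × ((suc r , c) ∈ E ⊎ (suc (suc r) , c) ∈ E)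

  -- Dropping the middle cell and then the top cell gives the jump of the top cell to the bottom.
  cleared-equal-ranks : ∀ {E E′} → InKD D₀ E → InKD D₀ E′ → Moved E′ E middle bottom → StackConfig E →
                        Rightmost E (suc (suc r)) c₁ → ρ E ≡ ρ E′
  cleared-equal-ranks {E} {E′} E∈KD E′∈KD mv cfg rightmost with StackConfig.right cfg
  ... | c₂ , c₁<c₂ , inj₂ top-right = ⊥-elim (<⇒≱ c₁<c₂ (rightmost c₂ top-right))
  ... | c₂ , c₁<c₂ , inj₁ middle-right = begin
    ρ E        ≡⟨ ρ-covers x E (jump-KD E∈KD top∈ rightmost r≥1 bottom∉ middle∈) E∈KD
                    (jump-covers E∈KD top∈ rightmost r≥1 bottom∉ middle∈ c₁<c₂ middle-right) ⟩
    suc (ρ x)  ≡⟨ ρ-covers-≈ E′∈KD (drop-KD E′∈KD top∈E′ rightmost′ (s≤s z≤n) middle∉E′)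
                    (drop-covers E′∈KD top∈E′ rightmost′ (s≤s z≤n) middle∉E′) E′-drop≈x ⟨
    ρ E′       ∎
    where
    open ≡-Reasoning
    open StackConfig cfg
    x = move E top bottom
    top∈E′ : top ∈ E′
    top∈E′ = Moved⁺ mv top∈ (row-≢ 1+r<2+r)
    rightmost′ : Rightmost E′ (suc (suc r)) c₁
    rightmost′ c h = rightmost c (Moved-row⁻ mv (<⇒≢ r<2+r) h)
    middle∉E′ : middle ∉ E′
    middle∉E′ = Moved-source∉ mv (row-≢ r<1+r)
    E′-drop≈x : move E′ top middle ≈D x
    E′-drop≈x = ≈D-trans (move-cong top middle (Moved⇒≈move mv))
                         (move-move E middle∈ (≢-sym (row-≢ 1+r<2+r)) (≢-sym (row-≢ r<2+r)))

  module TopRowDrop {E : Diagram} (cfg : StackConfig E) (max≢c₁ : rowMax (suc (suc r)) E ≢ c₁) where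

    open StackConfig cfg

    m : ℕ
    m = rowMax (suc (suc r)) E

    m-rightmost : Rightmost E (suc (suc r)) m
    m-rightmost = rowMax-rightmost (suc (suc r)) E

    m∈E : (suc (suc r) , m) ∈ E
    m∈E = rowMax-∈ E top∈

    c₁<m : c₁ < m
    c₁<m = ≤∧≢⇒< (m-rightmost c₁ top∈) (≢-sym max≢c₁)

    below-m∉E : (suc r , m) ∉ E
    below-m∉E = gap m c₁<m ≤-refl

    F : Diagram
    F = move E (suc (suc r) , m) (suc r , m)

    mv : Moved F E (suc (suc r) , m) (suc r , m)
    mv = move-Moved E (suc (suc r) , m) (suc r , m)

    F-rowMax-< : rowMax (suc (suc r)) F < m
    F-rowMax-< with Moved⁻ mv (rowMax-∈ F (Moved⁺ mv top∈ (col-≢ (<⇒≢ c₁<m))))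
    ... | inj₁ (max∈E , max≢m) = ≤∧≢⇒< (m-rightmost _ max∈E) (max≢m ∘ cong (suc (suc r) ,_))
    ... | inj₂ max≡below = ⊥-elim (row-≢ 1+r<2+r max≡below)

    F-config : StackConfig F
    F-config = record
      { middle∈ = Moved⁺ mv middle∈ (≢-sym (row-≢ 1+r<2+r))
      ; top∈ = Moved⁺ mv top∈ (col-≢ (<⇒≢ c₁<m))
      ; bottom∉ = Moved-∉ mv bottom∉ (≢-sym (row-≢ r<1+r))
      ; gap = F-gap
      ; right = m , c₁<m , inj₁ (Moved-target mv)
      }
      where
      F-gap : ∀ c → c₁ < c → c ≤ rowMax (suc (suc r)) F → (suc r , c) ∉ F
      F-gap c c₁<c c≤max x∈F with Moved⁻ mv x∈F
      ... | inj₁ (x∈E , _) = gap c c₁<c (≤-trans c≤max (<⇒≤ F-rowMax-<)) x∈E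
      ... | inj₂ x≡below = <⇒≢ (≤-<-trans c≤max F-rowMax-<) (,-injectiveʳ x≡below)

  -- Induction on the rightmost cell of the top row: dropping it to the middle row in both E and E′
  -- preserves the configuration, until the top row ends at column c₁.
  equal-ranks : ∀ k {E E′} → rowMax (suc (suc r)) E < k → InKD D₀ E → InKD D₀ E′ →
                Moved E′ E middle bottom → StackConfig E → ρ E ≡ ρ E′
  equal-ranks (suc k) {E} {E′} max<1+k E∈KD E′∈KD mv′ cfg with rowMax (suc (suc r)) E ≟ c₁
  ... | yes max≡c₁ = cleared-equal-ranks E∈KD E′∈KD mv′ cfg
                       (subst (Rightmost E (suc (suc r))) max≡c₁ (rowMax-rightmost (suc (suc r)) E))
  ... | no max≢c₁ = begin
    ρ E        ≡⟨ ρ-drop E∈KD m∈E m-rightmost (s≤s z≤n) below-m∉E ⟩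
    suc (ρ F)  ≡⟨ cong suc (equal-ranks k (≤-trans F-rowMax-< (≤-pred max<1+k)) F∈KD F′∈KD F′-moved F-config) ⟩
    suc (ρ F′) ≡⟨ ρ-drop E′∈KD m∈E′ m-rightmost′ (s≤s z≤n) below-m∉E′ ⟨
    ρ E′       ∎
    where
    open ≡-Reasoning
    open TopRowDrop cfg max≢c₁
    m∈E′ : (suc (suc r) , m) ∈ E′
    m∈E′ = Moved⁺ mv′ m∈E (row-≢ 1+r<2+r)
    m-rightmost′ : Rightmost E′ (suc (suc r)) m
    m-rightmost′ c h = m-rightmost c (Moved-row⁻ mv′ (<⇒≢ r<2+r) h)
    below-m∉E′ : (suc r , m) ∉ E′
    below-m∉E′ = Moved-∉ mv′ below-m∉E (row-≢ r<1+r)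
    F∈KD : InKD D₀ F
    F∈KD = drop-KD E∈KD m∈E m-rightmost (s≤s z≤n) below-m∉E
    F′ = move E′ (suc (suc r) , m) (suc r , m)
    F′∈KD : InKD D₀ F′
    F′∈KD = drop-KD E′∈KD m∈E′ m-rightmost′ (s≤s z≤n) below-m∉E′
    F′-moved : Moved F′ F middle bottom
    F′-moved = Moved-respˡ-≈ (≈D-sym (≈D-trans (move-cong (suc (suc r) , m) (suc r , m) (Moved⇒≈move mv′))
                                              (move-comm E (≢-sym (row-≢ r<2+r)) (col-≢ (≢-sym (<⇒≢ c₁<m))))))
                            (move-Moved F middle bottom)

  case-B : ∀ {D c₂} → InKD D₀ D → c₁ < c₂ → middle ∈ D → top ∈ D → (suc (suc r) , c₂) ∈ D →
           (∀ c → c₁ < c → (suc r , c) ∉ D) → bottom ∉ D → ⊥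
  case-B {D} {c₂} D∈KD c₁<c₂ middle∈ top∈ top-right middle-row-empty bottom∉ =
    suc-≢ (trans (sym (equal-ranks _ ≤-refl D∈KD E′∈KD mv cfg)) (ρ-drop D∈KD middle∈ rightmost r≥1 bottom∉))
    where
    E′ = move D middle bottom
    mv = move-Moved D middle bottom
    rightmost : Rightmost D (suc r) c₁
    rightmost c h = ≮⇒≥ (λ c₁<c → middle-row-empty c c₁<c h)
    E′∈KD : InKD D₀ E′
    E′∈KD = drop-KD D∈KD middle∈ rightmost r≥1 bottom∉
    cfg : StackConfig D
    cfg = record
      { middle∈ = middle∈ ; top∈ = top∈ ; bottom∉ = bottom∉
      ; gap = λ c c₁<c _ → middle-row-empty c c₁<c
      ; right = c₂ , c₁<c₂ , inj₂ top-right }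

  case-A : ∀ {D c₂} → InKD D₀ D → c₁ < c₂ → middle ∈ D → top ∈ D → (suc r , c₂) ∈ D →
           (∀ c → c₁ < c → (suc (suc r) , c) ∉ D) →
           (∀ c → c₁ < c → c < c₂ → (suc r , c) ∉ D) →
           (∀ c → c₂ < c → (suc r , c) ∉ D) → bottom ∉ D → (r , c₂) ∉ D → ⊥
  case-A {D} {c₂} D∈KD c₁<c₂ middle∈ top∈ right top-row-empty between-empty beyond-empty bottom∉ below-right∉ =
    suc-≢ (suc-injective (suc-injective (trans (sym via-jump) via-drops)))
    where
    c₁≢c₂ = <⇒≢ c₁<c₂
    top-rightmost : Rightmost D (suc (suc r)) c₁
    top-rightmost c h = ≮⇒≥ (λ c₁<c → top-row-empty c c₁<c h)
    right-rightmost : Rightmost D (suc r) c₂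
    right-rightmost c h = ≮⇒≥ (λ c₂<c → beyond-empty c c₂<c h)
    x = move D top bottom
    x∈KD = jump-KD D∈KD top∈ top-rightmost r≥1 bottom∉ middle∈
    mvx = move-Moved D top bottom
    right∈x : (suc r , c₂) ∈ x
    right∈x = Moved⁺ mvx right (≢-sym (row-≢ 1+r<2+r))
    x-rightmost : Rightmost x (suc r) c₂
    x-rightmost c h = right-rightmost c (Moved-row⁻ mvx (<⇒≢ r<1+r) h)
    below-right∉x : (r , c₂) ∉ x
    below-right∉x = Moved-∉ mvx below-right∉ (col-≢ (≢-sym c₁≢c₂))
    u = move D (suc r , c₂) (r , c₂)
    u∈KD = drop-KD D∈KD right right-rightmost r≥1 below-right∉
    mvu = move-Moved D (suc r , c₂) (r , c₂)
    middle∈u : middle ∈ u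
    middle∈u = Moved⁺ mvu middle∈ (col-≢ c₁≢c₂)
    u-rightmost : Rightmost u (suc r) c₁
    u-rightmost c h with Moved⁻ mvu h
    ... | inj₂ h≡below = ⊥-elim (row-≢ r<1+r h≡below)
    ... | inj₁ (h∈D , h≢right) with <-cmp c₁ c
    ...   | tri< c₁<c _ _ with <-cmp c c₂
    ...     | tri< c<c₂ _ _ = ⊥-elim (between-empty c c₁<c c<c₂ h∈D)
    ...     | tri≈ _ refl _ = ⊥-elim (h≢right refl)
    ...     | tri> _ _ c₂<c = ⊥-elim (beyond-empty c c₂<c h∈D)
    u-rightmost c h | inj₁ _ | tri≈ _ refl _ = ≤-refl
    u-rightmost c h | inj₁ _ | tri> _ _ c<c₁ = <⇒≤ c<c₁
    bottom∉u : bottom ∉ u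
    bottom∉u = Moved-∉ mvu bottom∉ (col-≢ c₁≢c₂)
    v = move u middle bottom
    mvv = move-Moved u middle bottom
    top∈v : top ∈ v
    top∈v = Moved⁺ mvv (Moved⁺ mvu top∈ (row-≢ 1+r<2+r)) (row-≢ 1+r<2+r)
    v-rightmost : Rightmost v (suc (suc r)) c₁
    v-rightmost c h = top-rightmost c (Moved-row⁻ mvu (<⇒≢ r<2+r) (Moved-row⁻ mvv (<⇒≢ r<2+r) h))
    v-drop≈w : move v top middle ≈D move x (suc r , c₂) (r , c₂)
    v-drop≈w = ≈D-trans (move-move u middle∈u (≢-sym (row-≢ 1+r<2+r)) (≢-sym (row-≢ r<2+r)))
                        (move-comm D (≢-sym (row-≢ r<2+r)) (col-≢ c₁≢c₂))
    open ≡-Reasoning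
    via-jump : ρ D ≡ suc (suc (ρ (move x (suc r , c₂) (r , c₂))))
    via-jump = begin
      ρ D       ≡⟨ ρ-covers x D x∈KD D∈KD (jump-covers D∈KD top∈ top-rightmost r≥1 bottom∉ middle∈ c₁<c₂ right) ⟩
      suc (ρ x) ≡⟨ cong suc (ρ-drop x∈KD right∈x x-rightmost r≥1 below-right∉x) ⟩
      _         ∎
    via-drops : ρ D ≡ suc (suc (suc (ρ (move x (suc r , c₂) (r , c₂)))))
    via-drops = begin
      ρ D             ≡⟨ ρ-drop D∈KD right right-rightmost r≥1 below-right∉ ⟩
      suc (ρ u)       ≡⟨ cong suc (ρ-drop u∈KD middle∈u u-rightmost r≥1 bottom∉u) ⟩
      suc (suc (ρ v)) ≡⟨ cong (suc ∘ suc) (ρ-covers-≈ v∈KD (drop-KD v∈KD top∈v v-rightmost (s≤s z≤n) middle∉v)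
                           (drop-covers v∈KD top∈v v-rightmost (s≤s z≤n) middle∉v) v-drop≈w) ⟩
      _               ∎
      where
      v∈KD = drop-KD u∈KD middle∈u u-rightmost r≥1 bottom∉u
      middle∉v = Moved-source∉ mvv (row-≢ r<1+r)

bound : Diagram → ℕ
bound [] = 0
bound ((a , b) ∷ D) = a ⊔ b ⊔ bound D

bound-boxed : ∀ D → Boxed (suc (bound D)) D
bound-boxed ((a , b) ∷ D) (here refl) =
  s≤s (≤-trans (m≤m⊔n a b) (m≤m⊔n (a ⊔ b) _)) , s≤s (≤-trans (m≤n⊔m a b) (m≤m⊔n (a ⊔ b) _))
bound-boxed ((a , b) ∷ D) (there x∈D) =
  let (r<N , c<N) = bound-boxed D x∈D in
  ≤-trans r<N (s≤s (m≤n⊔m (a ⊔ b) _)) , ≤-trans c<N (s≤s (m≤n⊔m (a ⊔ b) _))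

corollary3p6 : (D₀ : Diagram) → ValidDiagram D₀ →
    (D : Diagram) → InKD D₀ D →
    (r c₁ c₂ : ℕ) → 1 ≤ r → 1 ≤ c₁ → 1 ≤ c₂ → c₁ < c₂ →
    CondA D r c₁ c₂ ⊎ CondB D r c₁ c₂ →
    ¬ Ranked D₀
corollary3p6 D₀ _ D D∈KD r c₁ c₂ r≥1 _ _ c₁<c₂ (inj₁ (a₁ , a₂ , a₃ , a₄ , a₅ , a₆ , a₇ , a₈)) (ρ , _ , ρ-covers)
  rewrite +-comm r 1 | +-comm r 2 =
  NotRanked.case-A (bound-boxed D₀) ρ ρ-covers r≥1 D∈KD c₁<c₂ a₁ a₂ a₃ a₄ a₅ a₆ a₇ a₈
corollary3p6 D₀ _ D D∈KD r c₁ c₂ r≥1 _ _ c₁<c₂ (inj₂ (b₁ , b₂ , _ , b₄ , _ , b₆ , b₇)) (ρ , _ , ρ-covers)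
  rewrite +-comm r 1 | +-comm r 2 =
  NotRanked.case-B (bound-boxed D₀) ρ ρ-covers r≥1 D∈KD c₁<c₂ b₁ b₂ b₄ b₆ b₇
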